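{- The monotone neighborhood functor $\mathcal{M}$ does not admit a uniform construction that is adequate for the one-step formula $\neg\mathsf{Em}(a)$, where $\mathsf{Em}(a)$ abbreviates $\forall b.(a\subseteq b)$ (so that $(X,\alpha,V)\Vdash_1\neg\mathsf{Em}(a)$ iff $V(a)\neq\emptyset$).
   Context: The monotone neighborhood functor: $\mathcal{M}X=\{N\subseteq\mathcal{P}X\mid Z\in N,\ Z\subseteq Z'\subseteq X\Rightarrow Z'\in N\}$ and for $f:X\to Y$, $\mathcal{M}f(N)=\{Z\subseteq Y\mid f^{ -1}(Z)\in N\}$. A one-step model over $A=\{a\}$ is $(X,\alpha,V)$ with $\alpha\in\mathcal{M}X$, $V:A\to\mathcal{P}X$; the formula is a second-order one-step formula ($\forall b$ quantifies over subsets of $X$, $a\subseteq b$ means $V(a)\subseteq V(b)$). A one-step frame is $(X,\alpha)$, $\alpha\in\mathcal{M}X$; a morphism $h:(X',\alpha')\to(X,\alpha)$ is a map with $\mathcal{M}h(\alpha')=\alpha$. A uniform construction assigns to each frame $(X,\alpha)$ a frame $(X_*,\alpha_*)$ and morphism $h_\alpha:(X_*,\alpha_*)\to(X,\alpha)$. $V_{[h]}(a)=h^{ -1}(V(a))$. It is adequate for $\varphi$ if for all frames $(X,\alpha),(Y,\beta)$, every morphism $f:(X,\alpha)\to(Y,\beta)$ and $V:A\to\mathcal{P}Y$: $(X_*,\alpha_*,V_{[f\circ h_\alpha]})\Vdash_1\varphi$ iff $(Y_*,\beta_*,V_{[h_\beta]})\Vdash_1\varphi$. -}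

module Defs where

open import Level using (0ℓ)
open import Data.Unit using (⊤; tt)
open import Data.Product using (Σ; _×_; _,_)
open import Function using (_∘_; _⇔_)
open import Relation.Nullary using (¬_)
open import Relation.Unary using (Pred; _⊆_)

𝒫 : Set → Set₁
𝒫 X = Pred X 0ℓ

_⁻¹[_] : {X Y : Set} → (X → Y) → 𝒫 Y → 𝒫 X
f ⁻¹[ Z ] = Z ∘ f

record 𝓜 (X : Set) : Set₁ where
  field
    N      : Pred (𝒫 X) 0ℓ
    upward : ∀ {Z Z′ : 𝒫 X} → N Z → Z ⊆ Z′ → N Z′
open 𝓜 public

𝓜map : {X Y : Set} → (X → Y) → 𝓜 X → 𝓜 Y
𝓜map f α = record
  { N = λ Z → N α (f ⁻¹[ Z ])
  ; upward = λ p Z⊆Z′ → upward α p Z⊆Z′ }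

_≐_ : {X : Set} → 𝓜 X → 𝓜 X → Set₁
α ≐ β = ∀ Z → N α Z ⇔ N β Z

record Frame : Set₁ where
  constructor frame
  field
    carrier : Set
    nbhd    : 𝓜 carrier
open Frame public

IsMorphism : (F′ F : Frame) → (carrier F′ → carrier F) → Set₁
IsMorphism F′ F h = 𝓜map h (nbhd F′) ≐ nbhd F

A : Set
A = ⊤

a : A
a = tt

Valuation : Set → Set₁
Valuation X = A → 𝒫 X

_[_] : {X Y : Set} → Valuation Y → (X → Y) → Valuation X
(V [ h ]) p = h ⁻¹[ V p ]

record Model : Set₁ where
  constructor model
  field
    frm : Frame
    val : Valuation (carrier frm)
open Model public

⊩Em : Model → Set₁
⊩Em M = ∀ (b : 𝒫 (carrier (frm M))) → val M a ⊆ b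

⊩¬Em : Model → Set₁
⊩¬Em M = ¬ ⊩Em M

record UniformConstruction : Set₁ where
  field
    _* : Frame → Frame
    h  : (F : Frame) → carrier (F *) → carrier F
    h-morphism : (F : Frame) → IsMorphism (F *) F (h F)
open UniformConstruction public

Adequate¬Em : UniformConstruction → Set₁
Adequate¬Em U =
  ∀ (F G : Frame) (f : carrier F → carrier G) → IsMorphism F G f →
  ∀ (V : Valuation (carrier G)) →
    ⊩¬Em (model ((U *) F) (V [ f ∘ h U F ]))
      ⇔ ⊩¬Em (model ((U *) G) (V [ h U G ]))

-- Adequacy for ¬Em(a) forces, for every frame morphism f : F → G,
-- that each point h_G(x) of G hit by G_* is (not not) hit by f ∘ h_F as
-- well: take V(a) = {h_G(x)}; then x satisfies a in G_*, so ¬Em(a) holds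
-- there, hence also in F_*, which says V_[f ∘ h_F](a) is not empty.
-- On the frame (ℕ, cofinite filter) every shift n ↦ n + (j+1) is a frame
-- endomorphism that misses the point j.  Hence no point of ℕ_* can be
-- mapped to any j, i.e. ℕ_* is empty.  But a morphism into a frame that
-- contains the full set and not the empty set cannot have an empty
-- domain, and the cofinite filter is such a frame.
module Submission where

open import Defs
open import Data.Product using (Σ; _,_; ∃)
open import Relation.Nullary using (¬_)
open import Data.Nat using (ℕ; suc; _+_; _∸_; _≥_)
open import Data.Nat.Properties
  using (≤-refl; ≤-trans; m≤n+m; m≤n⇒m≤n+o; m+n≤o⇒m≤o∸n; m∸n+n≡m; m+1+n≢n)
open import Data.Empty using (⊥; ⊥-elim)
open import Data.Unit using (⊤; tt)
open import Function using (_∘_; _⇔_; mk⇔; Equivalence)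
open import Relation.Binary.PropositionalEquality using (_≡_; _≢_; refl; subst)

¬Em-intro : ∀ M {x} → val M a x → ⊩¬Em M
¬Em-intro M {x} ax em = em (λ _ → ⊥) ax

¬Em-elim : ∀ M → ⊩¬Em M → ¬ (∀ x → ¬ val M a x)
¬Em-elim M ¬em empty = ¬em λ b {x} ax → ⊥-elim (empty x ax)

adequate⇒image-covered :
  ∀ U → Adequate¬Em U →
  ∀ F G (f : carrier F → carrier G) → IsMorphism F G f →
  ∀ (x : carrier ((U *) G)) →
  ¬ (∀ y → f (h U F y) ≢ h U G x)
adequate⇒image-covered U adequate F G f f-mor x =
  ¬Em-elim (model ((U *) F) (V [ f ∘ h U F ]))
    (Equivalence.from (adequate F G f f-mor V)
      (¬Em-intro (model ((U *) G) (V [ h U G ])) refl))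
  where
  V : Valuation (carrier G)
  V _ y = y ≡ h U G x

-- A morphism into a frame whose neighbourhoods contain the full set but not
-- the empty set has a non-empty domain: otherwise the full set of the
-- domain, being a neighbourhood, equals the empty set.
morphism-domain-nonempty :
  ∀ F G (f : carrier F → carrier G) → IsMorphism F G f →
  N (nbhd G) (λ _ → ⊤) → ¬ N (nbhd G) (λ _ → ⊥) →
  ¬ (carrier F → ⊥)
morphism-domain-nonempty F G f f-mor full∈G ¬empty∈G empty =
  ¬empty∈G (Equivalence.to (f-mor (λ _ → ⊥)) empty∈F)
  where
  full∈F : N (nbhd F) (λ _ → ⊤)
  full∈F = Equivalence.from (f-mor (λ _ → ⊤)) full∈G
  empty∈F : N (nbhd F) (λ _ → ⊥)
  empty∈F = upward (nbhd F) full∈F λ {y} _ → empty y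

Cofinite : Frame
Cofinite = frame ℕ (record
  { N      = λ Z → ∃ λ m → ∀ n → n ≥ m → Z n
  ; upward = λ { (m , Z-from-m) Z⊆Z′ → m , λ n n≥m → Z⊆Z′ (Z-from-m n n≥m) } })

shift : ℕ → ℕ → ℕ
shift k n = n + k

shift-morphism : ∀ k → IsMorphism Cofinite Cofinite (shift k)
shift-morphism k Z = mk⇔ to from
  where
  to : N (𝓜map (shift k) (nbhd Cofinite)) Z → N (nbhd Cofinite) Z
  to (m , Z-from-m) = m + k , λ n n≥m+k →
    subst Z (m∸n+n≡m (≤-trans (m≤n+m k m) n≥m+k))
      (Z-from-m (n ∸ k) (m+n≤o⇒m≤o∸n m n≥m+k))
  from : N (nbhd Cofinite) Z → N (𝓜map (shift k) (nbhd Cofinite)) Z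
  from (m , Z-from-m) = m , λ n n≥m → Z-from-m (n + k) (m≤n⇒m≤n+o k n≥m)

shift-misses : ∀ j n → shift (suc j) n ≢ j
shift-misses j n = m+1+n≢n n

cofinite-full : N (nbhd Cofinite) (λ _ → ⊤)
cofinite-full = 0 , λ _ _ → tt

cofinite-proper : ¬ N (nbhd Cofinite) (λ _ → ⊥)
cofinite-proper (m , empty-from-m) = empty-from-m m ≤-refl

proposition6p1 : ¬ (Σ UniformConstruction Adequate¬Em)
proposition6p1 (U , adequate) =
  morphism-domain-nonempty ((U *) Cofinite) Cofinite (h U Cofinite)
    (h-morphism U Cofinite) cofinite-full cofinite-proper
    Cofinite*-empty
  where
  -- A point x of ℕ_* would have to lie over h(x), yet the shift by
  -- h(x) + 1 misses h(x).
  Cofinite*-empty : carrier ((U *) Cofinite) → ⊥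
  Cofinite*-empty x =
    adequate⇒image-covered U adequate Cofinite Cofinite (shift (suc j))
      (shift-morphism (suc j)) x (λ y → shift-misses j (h U Cofinite y))
    where
    j : ℕ
    j = h U Cofinite x
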